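{- Let $R=M_n(F)$ with $n>2$ and $F$ a finite field. Let $U$ be a subgroup of $GL_n(F)$ with $-I_n\in U$ such that $\Gamma(R,U)$ is connected. Let $\Gamma(R,S)$ be a $U$-unitary Cayley graph with $S\neq\emptyset$ and $S\neq M_n(F)\setminus\{0\}$. Then $\Gamma(R,S)$ is prime. In particular, if $U=GL_n(F)$ or $U=SL_n(F)$ (the latter with $-I_n\in SL_n(F)$), then every such $\Gamma(R,S)$ is prime.
   Context: For $S\subseteq R$ with $0\notin S$, $S=-S$, the Cayley graph $\Gamma(R,S)$ has vertex set $R$, with $a,b$ adjacent iff $a-b\in S$; it is $U$-unitary if $USU=S$. A subset $X$ of vertices of a graph $G$ is homogeneous if every vertex outside $X$ is adjacent to all or none of $X$; non-trivial if $2\le|X|<|V(G)|$; $G$ is prime if it has no non-trivial homogeneous set. -}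

module Defs where

open import Data.Nat using (ℕ; zero; suc)
open import Relation.Nullary.Decidable using (does)
open import Data.Bool using (not)
open import Data.Bool using (Bool; true; false; if_then_else_)
open import Data.Fin using (Fin; toℕ)
import Data.Fin as Fin
open import Data.Vec using (Vec; []; _∷_; lookup; tabulate; map; removeAt)
open import Data.Product using (Σ; ∃; _×_; _,_)
open import Data.Sum using (_⊎_)
open import Relation.Nullary using (¬_)
open import Relation.Binary.PropositionalEquality using (_≡_; _≢_)
open import Relation.Binary.Construct.Closure.ReflexiveTransitive using (Star)
open import Function.Bundles using (_↔_; _⇔_)
open import Algebra.Core using (Op₁; Op₂)
open import Algebra.Structures using (IsCommutativeRing)

record FiniteField : Set₁ where
  infixl 6 _+_
  infixl 7 _*_
  field
    Carrier           : Set
    _+_ _*_           : Op₂ Carrier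
    -_                : Op₁ Carrier
    0# 1#             : Carrier
    isCommutativeRing : IsCommutativeRing _≡_ _+_ _*_ -_ 0# 1#
    0≢1               : 0# ≢ 1#
    inverse           : ∀ x → x ≢ 0# → Σ Carrier (λ y → x * y ≡ 1#)
    size              : ℕ
    enum              : Carrier ↔ Fin size

module Matrices (F : FiniteField) (n : ℕ) where
  open FiniteField F

  SqMat : ℕ → Set
  SqMat m = Vec (Vec Carrier m) m

  Mat : Set
  Mat = SqMat n

  sumFin : ∀ {m} → (Fin m → Carrier) → Carrier
  sumFin {zero}  f = 0#
  sumFin {suc m} f = f Fin.zero + sumFin (λ i → f (Fin.suc i))

  entry : Mat → Fin n → Fin n → Carrier
  entry A i j = lookup (lookup A i) j

  fromFun : (Fin n → Fin n → Carrier) → Mat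
  fromFun f = tabulate (λ i → tabulate (λ j → f i j))

  0M : Mat
  0M = fromFun (λ _ _ → 0#)

  IM : Mat
  IM = fromFun (λ i j → if does (i Fin.≟ j) then 1# else 0#)

  _+M_ : Mat → Mat → Mat
  A +M B = fromFun (λ i j → entry A i j + entry B i j)

  -M_ : Mat → Mat
  -M A = fromFun (λ i j → - entry A i j)

  _-M_ : Mat → Mat → Mat
  A -M B = A +M (-M B)

  _*M_ : Mat → Mat → Mat
  A *M B = fromFun (λ i j → sumFin (λ k → entry A i k * entry B k j))

  isEven : ℕ → Bool
  isEven zero    = true
  isEven (suc k) = not (isEven k)

  sgn : ∀ {m} → Fin m → Carrier
  sgn j = if isEven (toℕ j) then 1# else - 1#

  det : ∀ {m} → SqMat m → Carrier
  det {zero}  []       = 1#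
  det {suc m} (r ∷ rs) =
    sumFin (λ j → sgn j * lookup r j * det (map (λ row → removeAt row j) rs))

  GL : Mat → Set
  GL A = Σ Mat (λ B → (A *M B ≡ IM) × (B *M A ≡ IM))

  SL : Mat → Set
  SL A = det A ≡ 1#

  record IsSubgroupOfGL (U : Mat → Set) : Set where
    field
      ⊆GL    : ∀ A → U A → GL A
      has-I  : U IM
      *-closed : ∀ A B → U A → U B → U (A *M B)
      inv-closed : ∀ A B → U A → A *M B ≡ IM → B *M A ≡ IM → U B

  -- subsets of R (decidable, as R is finite)
  Subset : Set
  Subset = Mat → Bool

  _∈_ : Mat → Subset → Set
  A ∈ X = X A ≡ true

  _∉_ : Mat → Subset → Set
  A ∉ X = ¬ (A ∈ X)

  IsConnectionSet : Subset → Set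
  IsConnectionSet S = (0M ∉ S) × (∀ A → (A ∈ S ⇔ (-M A) ∈ S))

  CayleyAdj : (Mat → Set) → Mat → Mat → Set
  CayleyAdj S a b = S (a -M b)

  Connected : (Mat → Mat → Set) → Set
  Connected Adj = ∀ a b → Star Adj a b

  IsUnitary : (Mat → Set) → Subset → Set
  IsUnitary U S =
    ∀ A → (A ∈ S ⇔ Σ Mat (λ u → Σ Mat (λ v → Σ Mat (λ s →
             U u × U v × s ∈ S × (A ≡ (u *M s) *M v)))))

  IsHomogeneous : (Mat → Mat → Set) → Subset → Set
  IsHomogeneous Adj X =
    ∀ v → v ∉ X → (∀ x → x ∈ X → Adj v x) ⊎ (∀ x → x ∈ X → ¬ Adj v x)

  IsNonTrivial : Subset → Set
  IsNonTrivial X =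
    Σ Mat (λ x → Σ Mat (λ y → x ∈ X × y ∈ X × x ≢ y)) × Σ Mat (λ z → z ∉ X)

  IsPrime : (Mat → Mat → Set) → Set
  IsPrime Adj = ∀ X → IsHomogeneous Adj X → ¬ IsNonTrivial X

  AllUnitaryPrime : (Mat → Set) → Set
  AllUnitaryPrime U =
    ∀ (S : Subset) → IsConnectionSet S → IsUnitary U S →
    ¬ (∀ A → A ∉ S) →
    ¬ (∀ A → (A ∈ S ⇔ A ≢ 0M)) →
    IsPrime (CayleyAdj (λ A → A ∈ S))

{-# OPTIONS --safe #-}
module Submission where

-- Let X be a non-trivial homogeneous set of Γ = Γ(R,S), translated so that 0 ∈ X.
-- Translations, and multiplications on either side by the elements of a set W ⊆ U of
-- units closed under inverses, are automorphisms of Γ and so carry X to homogeneous sets.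
-- Choose X maximal (induction on |R ∖ X|). An image Y ∋ 0 not contained in X would make
-- X ∪ Y a larger homogeneous set, hence all of R; but two homogeneous sets covering R,
-- neither inside the other, cannot exist when Γ and its complement are both connected.
-- Hence X is an additive subgroup stable under W on both sides, so X = R (contradicting
-- non-triviality) as soon as M_n(F) is simple over W. This holds for W = U when Γ(R,U)
-- is connected (every matrix is then a sum of elements of U) and for W = the
-- transvections, which lie in SL_n(F) ⊆ GL_n(F).
-- Simplicity over W also makes Γ and its complement connected: the vertices reachable
-- from 0 form such a subgroup.

open import Defs
open import Level using (0ℓ)
open import Algebra.Bundles using (CommutativeRing; Ring)
open import Algebra.Consequences.Propositional using (comm∧idˡ⇒id; comm∧invˡ⇒inv)
import Algebra.Properties.Monoid.Sum as MonoidSum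
open import Algebra.Structures using (IsRing)
open import Data.Bool using (Bool; true; false; if_then_else_; _∨_)
import Data.Bool as Bool
open import Data.Bool.Properties using (∨-zeroʳ; not-¬; ¬-not)
open import Data.Empty using (⊥; ⊥-elim)
open import Data.Fin using (Fin; zero; suc)
import Data.Fin as Fin
open import Data.Fin.Properties using (¬∀⟶∃¬; all?; <-cmp; <-asym; <⇒≢)
open import Data.List using (List; []; _∷_; cartesianProductWith)
import Data.List as List
open import Data.List.Membership.Propositional using () renaming (_∈_ to _∈ₗ_)
open import Data.List.Membership.Propositional.Properties using (∈-cartesianProductWith⁺; ∈-tabulate⁺)
open import Data.List.Relation.Unary.Any using (here; there)
open import Data.Nat using (ℕ; _<_; _≤_; s≤s; z≤n)
open import Data.Nat.Induction using (<-wellFounded)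
open import Data.Nat.Properties using (m≤n⇒m≤1+n; m<n⇒m<1+n; <⇒≤)
open import Data.Product using (_×_; ∃-syntax; _,_; proj₁; proj₂)
open import Data.Sum using (_⊎_; inj₁; inj₂; [_,_])
open import Data.Vec using (Vec; []; _∷_; lookup; tabulate; map; removeAt)
open import Data.Vec.Properties
  using (lookup∘tabulate; tabulate∘lookup; tabulate-cong; lookup-map; removeAt-punchOut)
open import Function using (_∘_)
open import Function.Bundles using (_⇔_; mk⇔; Equivalence; Inverse)
open import Function.Properties.Inverse using (↔⇒↣)
open import Induction.WellFounded using (Acc; acc)
open import Relation.Binary.Construct.Closure.ReflexiveTransitive using (Star; ε; _◅_; _◅◅_; gmap)
import Relation.Binary.Construct.Closure.ReflexiveTransitive as Star
open import Relation.Binary.Definitions using (DecidableEquality; Symmetric; tri<; tri≈; tri>)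
open import Relation.Binary.PropositionalEquality
  using (_≡_; _≢_; refl; sym; trans; cong; cong₂; subst; subst₂; module ≡-Reasoning)
open import Relation.Binary.PropositionalEquality.Algebra using (isMagma)
open import Relation.Nullary using (¬_; Dec)
open import Relation.Nullary.Decidable using (does; yes; no; via-injection; decidable-stable)

other-index : ∀ {n} → 1 < n → (i : Fin n) → ∃[ j ] i ≢ j
other-index (s≤s (s≤s _)) zero    = suc zero , λ ()
other-index (s≤s (s≤s _)) (suc i) = zero , λ ()

preserved-along : ∀ {A : Set} {R : A → A → Set} (P : A → Set) →
                  (∀ {x y} → R x y → P x → P y) → ∀ {x y} → Star R x y → P x → P y
preserved-along P step ε        px = px
preserved-along P step (r ◅ rs) px = preserved-along P step rs (step r px)

module Enumeration {A : Set} where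
  outside : (A → Bool) → List A → ℕ
  outside X []       = 0
  outside X (a ∷ as) = if X a then outside X as else ℕ.suc (outside X as)

  outside-antitone : ∀ {X Y : A → Bool} → (∀ w → X w ≡ true → Y w ≡ true) →
                     ∀ as → outside Y as ≤ outside X as
  outside-antitone X⊆Y [] = z≤n
  outside-antitone {X} {Y} X⊆Y (a ∷ as) with X a in Xa | Y a in Ya
  ... | true  | true  = outside-antitone X⊆Y as
  ... | true  | false = ⊥-elim (not-¬ Ya (X⊆Y a Xa))
  ... | false | true  = m≤n⇒m≤1+n (outside-antitone X⊆Y as)
  ... | false | false = s≤s (outside-antitone X⊆Y as)

  outside-< : ∀ {X Y : A → Bool} → (∀ w → X w ≡ true → Y w ≡ true) →
              ∀ {y as} → y ∈ₗ as → Y y ≡ true → X y ≢ true → outside Y as < outside X as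
  outside-< {X} {Y} X⊆Y {y} {a ∷ as} (here refl) Yy Xy≢true
    rewrite Yy | ¬-not Xy≢true = s≤s (outside-antitone X⊆Y as)
  outside-< {X} {Y} X⊆Y {y} {a ∷ as} (there y∈as) Yy Xy≢true with X a in Xa | Y a in Ya
  ... | true  | true  = outside-< X⊆Y y∈as Yy Xy≢true
  ... | true  | false = ⊥-elim (not-¬ Ya (X⊆Y a Xa))
  ... | false | true  = m<n⇒m<1+n (outside-< X⊆Y y∈as Yy Xy≢true)
  ... | false | false = s≤s (outside-< X⊆Y y∈as Yy Xy≢true)

  vectors : List A → ∀ k → List (Vec A k)
  vectors as ℕ.zero    = [] ∷ []
  vectors as (ℕ.suc k) = cartesianProductWith _∷_ as (vectors as k)

  ∈-vectors : ∀ {as} → (∀ a → a ∈ₗ as) → ∀ {k} (v : Vec A k) → v ∈ₗ vectors as k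
  ∈-vectors ∈as []      = here refl
  ∈-vectors ∈as (a ∷ v) = ∈-cartesianProductWith⁺ _∷_ (∈as a) (∈-vectors ∈as v)

module Homogeneity (F : FiniteField) (n : ℕ) where
  open Matrices F n

  Complement : (Mat → Mat → Set) → Mat → Mat → Set
  Complement Adj a b = ¬ Adj a b

  _∈?_ : ∀ A X → Dec (A ∈ X)
  A ∈? X = X A Bool.≟ true

  _∪_ : Subset → Subset → Subset
  (X ∪ Y) w = X w ∨ Y w

  ∪-introˡ : ∀ {X Y w} → w ∈ X → w ∈ (X ∪ Y)
  ∪-introˡ {Y = Y} {w} w∈X = cong (_∨ Y w) w∈X

  ∪-introʳ : ∀ {X Y w} → w ∈ Y → w ∈ (X ∪ Y)
  ∪-introʳ {X} {w = w} w∈Y = trans (cong (X w ∨_) w∈Y) (∨-zeroʳ (X w))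

  ∪-elim : ∀ {X Y w} → w ∈ (X ∪ Y) → w ∈ X ⊎ w ∈ Y
  ∪-elim {X} {w = w} with X w
  ... | true  = λ _ → inj₁ refl
  ... | false = inj₂

  complement-homogeneous : ∀ {Adj X} → IsHomogeneous Adj X → IsHomogeneous (Complement Adj) X
  complement-homogeneous X-hom v v∉X with X-hom v v∉X
  ... | inj₁ adjacent     = inj₂ λ x x∈X v≁x → v≁x (adjacent x x∈X)
  ... | inj₂ non-adjacent = inj₁ non-adjacent

  ∪-homogeneous : ∀ {Adj X Y c} → IsHomogeneous Adj X → IsHomogeneous Adj Y → c ∈ X → c ∈ Y →
                  IsHomogeneous Adj (X ∪ Y)
  ∪-homogeneous {X = X} {Y} {c} X-hom Y-hom c∈X c∈Y v v∉X∪Y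
    with X-hom v (v∉X∪Y ∘ ∪-introˡ {X} {Y}) | Y-hom v (v∉X∪Y ∘ ∪-introʳ {X} {Y})
  ... | inj₁ adj-X  | inj₁ adj-Y  = inj₁ λ x x∈X∪Y → [ adj-X x , adj-Y x ] (∪-elim {X} {Y} x∈X∪Y)
  ... | inj₂ ¬adj-X | inj₂ ¬adj-Y = inj₂ λ x x∈X∪Y → [ ¬adj-X x , ¬adj-Y x ] (∪-elim {X} {Y} x∈X∪Y)
  ... | inj₁ adj-X  | inj₂ ¬adj-Y = ⊥-elim (¬adj-Y c c∈Y (adj-X c c∈X))
  ... | inj₂ ¬adj-X | inj₁ adj-Y  = ⊥-elim (¬adj-X c c∈X (adj-Y c c∈Y))

  preimage-homogeneous : ∀ {Adj X} (φ : Mat → Mat) → (∀ a b → Adj (φ a) (φ b) ⇔ Adj a b) →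
                         IsHomogeneous Adj X → IsHomogeneous Adj (X ∘ φ)
  preimage-homogeneous φ φ-iso X-hom v φv∉X with X-hom (φ v) φv∉X
  ... | inj₁ adjacent     = inj₁ λ x φx∈X → Equivalence.to (φ-iso v x) (adjacent (φ x) φx∈X)
  ... | inj₂ non-adjacent = inj₂ λ x φx∈X v~x → non-adjacent (φ x) φx∈X (Equivalence.from (φ-iso v x) v~x)

  -- b is adjacent to all of X, hence every vertex of X ∖ Y to all of Y; so a path of
  -- non-edges starting at a stays inside X ∖ Y and cannot reach b.
  adjacent-cover : ∀ {Adj X Y a b} → Symmetric Adj → Connected (Complement Adj) →
                   IsHomogeneous Adj X → IsHomogeneous Adj Y → (∀ w → w ∈ X ⊎ w ∈ Y) →
                   a ∈ X → a ∉ Y → b ∈ Y → b ∉ X → ¬ Adj a b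
  adjacent-cover {Adj} {X} {Y} {a} {b} Adj-sym co-connected X-hom Y-hom X∪Y-full a∈X a∉Y b∈Y b∉X a~b =
    b∉X (proj₁ (preserved-along In-X∖Y step (co-connected a b) (a∈X , a∉Y)))
    where
    In-X∖Y : Mat → Set
    In-X∖Y x = x ∈ X × x ∉ Y
    b~X : ∀ x → x ∈ X → Adj b x
    b~X with X-hom b b∉X
    ... | inj₁ adjacent     = adjacent
    ... | inj₂ non-adjacent = ⊥-elim (non-adjacent a a∈X (Adj-sym a~b))
    X∖Y~Y : ∀ x → In-X∖Y x → ∀ y → y ∈ Y → Adj x y
    X∖Y~Y x (x∈X , x∉Y) with Y-hom x x∉Y
    ... | inj₁ adjacent     = adjacent
    ... | inj₂ non-adjacent = ⊥-elim (non-adjacent b b∈Y (Adj-sym (b~X x x∈X)))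
    step : ∀ {x w} → ¬ Adj x w → In-X∖Y x → In-X∖Y w
    step {x} {w} x≁w x∈X∖Y with X∪Y-full w
    ... | inj₁ w∈X = w∈X , λ w∈Y → x≁w (X∖Y~Y x x∈X∖Y w w∈Y)
    ... | inj₂ w∈Y = ⊥-elim (x≁w (X∖Y~Y x x∈X∖Y w w∈Y))

  homogeneous-cover : ∀ {Adj X Y a b} → Symmetric Adj → (∀ a b → Dec (Adj a b)) →
                      Connected Adj → Connected (Complement Adj) →
                      IsHomogeneous Adj X → IsHomogeneous Adj Y → (∀ w → w ∈ X ⊎ w ∈ Y) →
                      a ∈ X → a ∉ Y → b ∈ Y → b ∉ X → ⊥
  homogeneous-cover {a = a} {b} Adj-sym Adj? connected co-connected X-hom Y-hom X∪Y-full a∈X a∉Y b∈Y b∉X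
    with Adj? a b
  ... | yes a~b = adjacent-cover Adj-sym co-connected X-hom Y-hom X∪Y-full a∈X a∉Y b∈Y b∉X a~b
  ... | no a≁b  = adjacent-cover (λ x≁y y~x → x≁y (Adj-sym y~x))
                    (λ x y → Star.map (λ x~y x≁y → x≁y x~y) (connected x y))
                    (complement-homogeneous X-hom) (complement-homogeneous Y-hom)
                    X∪Y-full a∈X a∉Y b∈Y b∉X a≁b

module FieldAlgebra (F : FiniteField) where
  open FiniteField F public

  commutativeRing : CommutativeRing 0ℓ 0ℓ
  commutativeRing = record { isCommutativeRing = isCommutativeRing }

  open import Algebra.Properties.Ring (CommutativeRing.ring commutativeRing) public
    using (-‿involutive)
  open CommutativeRing commutativeRing public
    using ( +-assoc; +-comm; +-identityˡ; +-identityʳ; -‿inverseˡ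
          ; *-assoc; *-comm; *-identityˡ; *-identityʳ; distribˡ; distribʳ
          ; zeroˡ; zeroʳ; semiring; *-commutativeMonoid)
  open import Algebra.Properties.Semiring.Sum semiring public
    using (sum; sum-cong-≗; sum-replicate-zero; ∑-distrib-+; ∑-comm; *-distribˡ-sum; *-distribʳ-sum)
  open import Algebra.Solver.CommutativeMonoid *-commutativeMonoid public
    using (solve; _⊕_; _⊜_)

  _≟_ : DecidableEquality Carrier
  _≟_ = via-injection (↔⇒↣ enum) Fin._≟_

  ∑-zero : ∀ {m} {f : Fin m → Carrier} → (∀ k → f k ≡ 0#) → sum f ≡ 0#
  ∑-zero {m} f≗0 = trans (sum-cong-≗ f≗0) (sum-replicate-zero m)

  δ : ∀ {m} → Fin m → Fin m → Carrier
  δ i j = if does (i Fin.≟ j) then 1# else 0#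

  δ-refl : ∀ {m} (i : Fin m) → δ i i ≡ 1#
  δ-refl i with i Fin.≟ i
  ... | yes _  = refl
  ... | no i≢i = ⊥-elim (i≢i refl)

  δ-≢ : ∀ {m} {i j : Fin m} → i ≢ j → δ i j ≡ 0#
  δ-≢ {i = i} {j} i≢j with i Fin.≟ j
  ... | yes i≡j = ⊥-elim (i≢j i≡j)
  ... | no _    = refl

  δ-sym : ∀ {m} (i j : Fin m) → δ i j ≡ δ j i
  δ-sym i j with i Fin.≟ j | j Fin.≟ i
  ... | yes _   | yes _   = refl
  ... | no _    | no _    = refl
  ... | yes i≡j | no j≢i  = ⊥-elim (j≢i (sym i≡j))
  ... | no i≢j  | yes j≡i = ⊥-elim (i≢j (sym j≡i))

  δδ≡0 : ∀ {m} {p q i j : Fin m} → ¬ (p ≡ i × q ≡ j) → δ p i * δ q j ≡ 0#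
  δδ≡0 {p = p} {q} {i} {j} ¬pq≡ij with p Fin.≟ i | q Fin.≟ j
  ... | no _    | _       = zeroˡ _
  ... | yes _   | no _    = zeroʳ _
  ... | yes p≡i | yes q≡j = ⊥-elim (¬pq≡ij (p≡i , q≡j))

  ∑-δ : ∀ {m} (i : Fin m) (f : Fin m → Carrier) → sum (λ k → δ k i * f k) ≡ f i
  ∑-δ zero    f = trans (cong₂ _+_ (*-identityˡ _) (∑-zero (λ k → zeroˡ (f (suc k))))) (+-identityʳ _)
  ∑-δ (suc i) f = trans (cong₂ _+_ (zeroˡ _) (∑-δ i (λ k → f (suc k)))) (+-identityˡ _)

  ∑-δ′ : ∀ {m} (i : Fin m) (f : Fin m → Carrier) → sum (λ k → δ i k * f k) ≡ f i
  ∑-δ′ i f = trans (sum-cong-≗ (λ k → cong (_* f k) (δ-sym i k))) (∑-δ i f)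

module MatrixRing (F : FiniteField) (n : ℕ) where
  open FieldAlgebra F
  open Matrices F n
  open ≡-Reasoning

  sumFin≡sum : ∀ {m} (f : Fin m → Carrier) → sumFin f ≡ sum f
  sumFin≡sum {ℕ.zero}  f = refl
  sumFin≡sum {ℕ.suc m} f = cong (f zero +_) (sumFin≡sum (λ k → f (suc k)))

  entry-fromFun : ∀ f i j → entry (fromFun f) i j ≡ f i j
  entry-fromFun f i j =
    trans (cong (λ row → lookup row j) (lookup∘tabulate _ i)) (lookup∘tabulate _ j)

  fromFun-cong : ∀ {f g} → (∀ i j → f i j ≡ g i j) → fromFun f ≡ fromFun g
  fromFun-cong f≗g = tabulate-cong (λ i → tabulate-cong (f≗g i))

  fromFun-entry : ∀ A → fromFun (entry A) ≡ A
  fromFun-entry A = trans (tabulate-cong (λ i → tabulate∘lookup (lookup A i))) (tabulate∘lookup A)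

  ≡-entrywise : ∀ {A B} → (∀ i j → entry A i j ≡ entry B i j) → A ≡ B
  ≡-entrywise {A} {B} A≗B = begin
    A               ≡⟨ fromFun-entry A ⟨
    fromFun (entry A) ≡⟨ fromFun-cong A≗B ⟩
    fromFun (entry B) ≡⟨ fromFun-entry B ⟩
    B               ∎

  entry-0M : ∀ i j → entry 0M i j ≡ 0#
  entry-0M = entry-fromFun _

  entry-IM : ∀ i j → entry IM i j ≡ δ i j
  entry-IM = entry-fromFun _

  entry-+M : ∀ A B i j → entry (A +M B) i j ≡ entry A i j + entry B i j
  entry-+M A B = entry-fromFun _

  entry-‿M : ∀ A i j → entry (-M A) i j ≡ - entry A i j
  entry-‿M A = entry-fromFun _

  entry-*M : ∀ A B i j → entry (A *M B) i j ≡ sum (λ k → entry A i k * entry B k j)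
  entry-*M A B i j =
    trans (entry-fromFun _ i j) (sumFin≡sum (λ k → entry A i k * entry B k j))

  +M-assoc : ∀ A B C → (A +M B) +M C ≡ A +M (B +M C)
  +M-assoc A B C = fromFun-cong λ i j → begin
    entry (A +M B) i j + entry C i j          ≡⟨ cong (_+ entry C i j) (entry-+M A B i j) ⟩
    (entry A i j + entry B i j) + entry C i j ≡⟨ +-assoc _ _ _ ⟩
    entry A i j + (entry B i j + entry C i j) ≡⟨ cong (entry A i j +_) (entry-+M B C i j) ⟨
    entry A i j + entry (B +M C) i j          ∎

  +M-comm : ∀ A B → A +M B ≡ B +M A
  +M-comm A B = fromFun-cong λ i j → +-comm _ _

  +M-identityˡ : ∀ A → 0M +M A ≡ A
  +M-identityˡ A = ≡-entrywise λ i j → begin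
    entry (0M +M A) i j       ≡⟨ entry-+M 0M A i j ⟩
    entry 0M i j + entry A i j ≡⟨ cong (_+ entry A i j) (entry-0M i j) ⟩
    0# + entry A i j          ≡⟨ +-identityˡ _ ⟩
    entry A i j               ∎

  +M-inverseˡ : ∀ A → (-M A) +M A ≡ 0M
  +M-inverseˡ A = fromFun-cong λ i j →
    trans (cong (_+ entry A i j) (entry-‿M A i j)) (-‿inverseˡ _)

  *M-assoc : ∀ A B C → (A *M B) *M C ≡ A *M (B *M C)
  *M-assoc A B C = ≡-entrywise λ i j → begin
    entry ((A *M B) *M C) i j
      ≡⟨ entry-*M (A *M B) C i j ⟩
    sum (λ l → entry (A *M B) i l * c l j)
      ≡⟨ sum-cong-≗ (λ l → cong (_* c l j) (entry-*M A B i l)) ⟩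
    sum (λ l → sum (λ k → a i k * b k l) * c l j)
      ≡⟨ sum-cong-≗ (λ l → *-distribʳ-sum (c l j) (λ k → a i k * b k l)) ⟩
    sum (λ l → sum (λ k → (a i k * b k l) * c l j))
      ≡⟨ ∑-comm (λ l k → (a i k * b k l) * c l j) ⟩
    sum (λ k → sum (λ l → (a i k * b k l) * c l j))
      ≡⟨ sum-cong-≗ (λ k → sum-cong-≗ (λ l → *-assoc (a i k) (b k l) (c l j))) ⟩
    sum (λ k → sum (λ l → a i k * (b k l * c l j)))
      ≡⟨ sum-cong-≗ (λ k → *-distribˡ-sum (a i k) (λ l → b k l * c l j)) ⟨
    sum (λ k → a i k * sum (λ l → b k l * c l j))
      ≡⟨ sum-cong-≗ (λ k → cong (a i k *_) (entry-*M B C k j)) ⟨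
    sum (λ k → a i k * entry (B *M C) k j)
      ≡⟨ entry-*M A (B *M C) i j ⟨
    entry (A *M (B *M C)) i j ∎
    where a = entry A; b = entry B; c = entry C

  *M-identityˡ : ∀ A → IM *M A ≡ A
  *M-identityˡ A = ≡-entrywise λ i j → begin
    entry (IM *M A) i j                   ≡⟨ entry-*M IM A i j ⟩
    sum (λ k → entry IM i k * entry A k j) ≡⟨ sum-cong-≗ (λ k → cong (_* entry A k j) (entry-IM i k)) ⟩
    sum (λ k → δ i k * entry A k j)        ≡⟨ ∑-δ′ i (λ k → entry A k j) ⟩
    entry A i j                           ∎

  *M-identityʳ : ∀ A → A *M IM ≡ A
  *M-identityʳ A = ≡-entrywise λ i j → begin
    entry (A *M IM) i j
      ≡⟨ entry-*M A IM i j ⟩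
    sum (λ k → entry A i k * entry IM k j)
      ≡⟨ sum-cong-≗ (λ k → trans (*-comm _ _) (cong (_* entry A i k) (entry-IM k j))) ⟩
    sum (λ k → δ k j * entry A i k)
      ≡⟨ ∑-δ j (entry A i) ⟩
    entry A i j ∎

  *M-distribˡ : ∀ A B C → A *M (B +M C) ≡ (A *M B) +M (A *M C)
  *M-distribˡ A B C = ≡-entrywise λ i j → begin
    entry (A *M (B +M C)) i j
      ≡⟨ entry-*M A (B +M C) i j ⟩
    sum (λ k → entry A i k * entry (B +M C) k j)
      ≡⟨ sum-cong-≗ (λ k → trans (cong (entry A i k *_) (entry-+M B C k j)) (distribˡ _ _ _)) ⟩
    sum (λ k → entry A i k * entry B k j + entry A i k * entry C k j)
      ≡⟨ ∑-distrib-+ (λ k → entry A i k * entry B k j) (λ k → entry A i k * entry C k j) ⟩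
    sum (λ k → entry A i k * entry B k j) + sum (λ k → entry A i k * entry C k j)
      ≡⟨ cong₂ _+_ (entry-*M A B i j) (entry-*M A C i j) ⟨
    entry (A *M B) i j + entry (A *M C) i j
      ≡⟨ entry-+M (A *M B) (A *M C) i j ⟨
    entry ((A *M B) +M (A *M C)) i j ∎

  *M-distribʳ : ∀ A B C → (B +M C) *M A ≡ (B *M A) +M (C *M A)
  *M-distribʳ A B C = ≡-entrywise λ i j → begin
    entry ((B +M C) *M A) i j
      ≡⟨ entry-*M (B +M C) A i j ⟩
    sum (λ k → entry (B +M C) i k * entry A k j)
      ≡⟨ sum-cong-≗ (λ k → trans (cong (_* entry A k j) (entry-+M B C i k)) (distribʳ _ _ _)) ⟩
    sum (λ k → entry B i k * entry A k j + entry C i k * entry A k j)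
      ≡⟨ ∑-distrib-+ (λ k → entry B i k * entry A k j) (λ k → entry C i k * entry A k j) ⟩
    sum (λ k → entry B i k * entry A k j) + sum (λ k → entry C i k * entry A k j)
      ≡⟨ cong₂ _+_ (entry-*M B A i j) (entry-*M C A i j) ⟨
    entry (B *M A) i j + entry (C *M A) i j
      ≡⟨ entry-+M (B *M A) (C *M A) i j ⟨
    entry ((B *M A) +M (C *M A)) i j ∎

  isRing : IsRing _≡_ _+M_ _*M_ -M_ 0M IM
  isRing = record
    { +-isAbelianGroup = record
      { isGroup = record
        { isMonoid = record
          { isSemigroup = record { isMagma = isMagma _+M_ ; assoc = +M-assoc }
          ; identity    = comm∧idˡ⇒id +M-comm {0M} +M-identityˡ
          }
        ; inverse = comm∧invˡ⇒inv {_⁻¹ = -M_} {0M} +M-comm +M-inverseˡ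
        ; ⁻¹-cong = cong (-M_)
        }
      ; comm = +M-comm
      }
    ; *-cong     = cong₂ _*M_
    ; *-assoc    = *M-assoc
    ; *-identity = *M-identityˡ , *M-identityʳ
    ; distrib    = *M-distribˡ , *M-distribʳ
    }

  ring : Ring 0ℓ 0ℓ
  ring = record { isRing = isRing }

  open Ring ring public using ()
    renaming (zeroˡ to *M-zeroˡ; zeroʳ to *M-zeroʳ; +-identityʳ to +M-identityʳ; -‿inverseʳ to -M-inverseʳ)
  open import Algebra.Properties.Ring ring
    using (//-rightDividesˡ; ⁻¹-anti-homo‿-; -‿anti-homo-+)
    renaming (-‿involutive to -M-involutive)
  open import Algebra.Properties.Ring ring public using (//-rightDividesʳ)
  open import Algebra.Properties.Ring ring public using ()
    renaming (x[y-z]≈xy-xz to x[y-z]≡xy-xz; [y-z]x≈yx-zx to [y-z]x≡yx-zx)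

  x-y+y≡x : ∀ x y → (x -M y) +M y ≡ x
  x-y+y≡x x y = //-rightDividesˡ y x

  -[x-y]≡y-x : ∀ x y → -M (x -M y) ≡ y -M x
  -[x-y]≡y-x = ⁻¹-anti-homo‿-

  x-[-y]≡x+y : ∀ x y → x -M (-M y) ≡ x +M y
  x-[-y]≡x+y x y = cong (x +M_) (-M-involutive y)

  *M-cancelˡ : ∀ {u v} → v *M u ≡ IM → ∀ a → v *M (u *M a) ≡ a
  *M-cancelˡ {u} {v} vu≡I a = trans (sym (*M-assoc v u a)) (trans (cong (_*M a) vu≡I) (*M-identityˡ a))

  *M-cancelʳ : ∀ {u v} → u *M v ≡ IM → ∀ a → (a *M u) *M v ≡ a
  *M-cancelʳ {u} {v} uv≡I a = trans (*M-assoc a u v) (trans (cong (a *M_) uv≡I) (*M-identityʳ a))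

  [x+z]-[y+z]≡x-y : ∀ x y z → (x +M z) -M (y +M z) ≡ x -M y
  [x+z]-[y+z]≡x-y x y z = begin
    (x +M z) +M (-M (y +M z))      ≡⟨ cong ((x +M z) +M_) (-‿anti-homo-+ y z) ⟩
    (x +M z) +M ((-M z) +M (-M y)) ≡⟨ +M-assoc (x +M z) (-M z) (-M y) ⟨
    ((x +M z) -M z) +M (-M y)      ≡⟨ cong (_+M (-M y)) (//-rightDividesʳ z x) ⟩
    x -M y                         ∎

module MatrixUnits (F : FiniteField) (n : ℕ) where
  open FieldAlgebra F
  open Matrices F n
  open MatrixRing F n
  open ≡-Reasoning

  module MatrixSum = MonoidSum (Ring.+-monoid ring)

  E : Fin n → Fin n → Carrier → Mat
  E i j c = fromFun (λ p q → (δ p i * δ q j) * c)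

  entry-E : ∀ i j c p q → entry (E i j c) p q ≡ (δ p i * δ q j) * c
  entry-E i j c = entry-fromFun _

  entry-E*M : ∀ i k a s p q → entry (E i k a *M s) p q ≡ δ p i * (a * entry s k q)
  entry-E*M i k a s p q = begin
    entry (E i k a *M s) p q
      ≡⟨ entry-*M (E i k a) s p q ⟩
    sum (λ r → entry (E i k a) p r * entry s r q)
      ≡⟨ sum-cong-≗ (λ r → cong (_* entry s r q) (entry-E i k a p r)) ⟩
    sum (λ r → ((δ p i * δ r k) * a) * entry s r q)
      ≡⟨ sum-cong-≗ (λ r → reorder (δ p i) (δ r k) a (entry s r q)) ⟩
    sum (λ r → δ r k * (δ p i * (a * entry s r q)))
      ≡⟨ ∑-δ k (λ r → δ p i * (a * entry s r q)) ⟩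
    δ p i * (a * entry s k q) ∎
    where
    reorder : ∀ x y z w → ((x * y) * z) * w ≡ y * (x * (z * w))
    reorder = solve 4 (λ x y z w → ((x ⊕ y) ⊕ z) ⊕ w ⊜ y ⊕ (x ⊕ (z ⊕ w))) refl

  entry-*ME : ∀ s l j b p q → entry (s *M E l j b) p q ≡ (entry s p l * b) * δ q j
  entry-*ME s l j b p q = begin
    entry (s *M E l j b) p q
      ≡⟨ entry-*M s (E l j b) p q ⟩
    sum (λ r → entry s p r * entry (E l j b) r q)
      ≡⟨ sum-cong-≗ (λ r → cong (entry s p r *_) (entry-E l j b r q)) ⟩
    sum (λ r → entry s p r * ((δ r l * δ q j) * b))
      ≡⟨ sum-cong-≗ (λ r → reorder (entry s p r) (δ r l) (δ q j) b) ⟩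
    sum (λ r → δ r l * ((entry s p r * b) * δ q j))
      ≡⟨ ∑-δ l (λ r → (entry s p r * b) * δ q j) ⟩
    (entry s p l * b) * δ q j ∎
    where
    reorder : ∀ x y z w → x * ((y * z) * w) ≡ y * ((x * w) * z)
    reorder = solve 4 (λ x y z w → x ⊕ ((y ⊕ z) ⊕ w) ⊜ y ⊕ ((x ⊕ w) ⊕ z)) refl

  E-sandwich : ∀ i k l j a b s → (E i k a *M s) *M E l j b ≡ E i j ((a * entry s k l) * b)
  E-sandwich i k l j a b s = ≡-entrywise λ p q → begin
    entry ((E i k a *M s) *M E l j b) p q       ≡⟨ entry-*ME (E i k a *M s) l j b p q ⟩
    (entry (E i k a *M s) p l * b) * δ q j      ≡⟨ cong (λ x → (x * b) * δ q j) (entry-E*M i k a s p l) ⟩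
    ((δ p i * (a * entry s k l)) * b) * δ q j   ≡⟨ reorder (δ p i) (δ q j) a (entry s k l) b ⟩
    (δ p i * δ q j) * ((a * entry s k l) * b)   ≡⟨ entry-E i j _ p q ⟨
    entry (E i j ((a * entry s k l) * b)) p q   ∎
    where
    reorder : ∀ x y z w v → ((x * (z * w)) * v) * y ≡ (x * y) * ((z * w) * v)
    reorder = solve 5 (λ x y z w v → ((x ⊕ (z ⊕ w)) ⊕ v) ⊕ y ⊜ (x ⊕ y) ⊕ ((z ⊕ w) ⊕ v)) refl

  E-zero : ∀ i j → E i j 0# ≡ 0M
  E-zero i j = fromFun-cong λ p q → zeroʳ _

  E-+ : ∀ i j a b → E i j (a + b) ≡ E i j a +M E i j b
  E-+ i j a b = fromFun-cong λ p q →
    trans (distribˡ _ a b) (sym (cong₂ _+_ (entry-E i j a p q) (entry-E i j b p q)))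

  E*E-≢ : ∀ {i j} → i ≢ j → ∀ a b → E i j a *M E i j b ≡ 0M
  E*E-≢ {i} {j} i≢j a b = begin
    E i j a *M E i j b              ≡⟨ cong (_*M E i j b) (*M-identityʳ (E i j a)) ⟨
    (E i j a *M IM) *M E i j b      ≡⟨ E-sandwich i j i j a b IM ⟩
    E i j ((a * entry IM j i) * b)  ≡⟨ cong (λ x → E i j ((a * x) * b)) (trans (entry-IM j i) (δ-≢ (i≢j ∘ sym))) ⟩
    E i j ((a * 0#) * b)            ≡⟨ cong (E i j) (trans (cong (_* b) (zeroʳ a)) (zeroˡ b)) ⟩
    E i j 0#                        ≡⟨ E-zero i j ⟩
    0M                              ∎

  E*E-diagonal : ∀ i j c → E i j c *M E j i 1# ≡ E i i c
  E*E-diagonal i j c = begin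
    E i j c *M E j i 1#              ≡⟨ cong (_*M E j i 1#) (*M-identityʳ (E i j c)) ⟨
    (E i j c *M IM) *M E j i 1#      ≡⟨ E-sandwich i j j i c 1# IM ⟩
    E i i ((c * entry IM j j) * 1#)  ≡⟨ cong (λ x → E i i ((c * x) * 1#)) (trans (entry-IM j j) (δ-refl j)) ⟩
    E i i ((c * 1#) * 1#)            ≡⟨ cong (E i i) (trans (*-identityʳ _) (*-identityʳ c)) ⟩
    E i i c                          ∎

  entry-∑ᴹ : ∀ {m} (f : Fin m → Mat) p q → entry (MatrixSum.sum f) p q ≡ sum (λ k → entry (f k) p q)
  entry-∑ᴹ {ℕ.zero}  f p q = entry-0M p q
  entry-∑ᴹ {ℕ.suc m} f p q =
    trans (entry-+M (f zero) (MatrixSum.sum (λ k → f (suc k))) p q)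
          (cong (entry (f zero) p q +_) (entry-∑ᴹ (λ k → f (suc k)) p q))

  E-decomposition : ∀ A → A ≡ MatrixSum.sum (λ i → MatrixSum.sum (λ j → E i j (entry A i j)))
  E-decomposition A = ≡-entrywise λ p q → sym (begin
    entry (MatrixSum.sum (λ i → MatrixSum.sum (λ j → E i j (a i j)))) p q
      ≡⟨ entry-∑ᴹ (λ i → MatrixSum.sum (λ j → E i j (a i j))) p q ⟩
    sum (λ i → entry (MatrixSum.sum (λ j → E i j (a i j))) p q)
      ≡⟨ sum-cong-≗ (λ i → entry-∑ᴹ (λ j → E i j (a i j)) p q) ⟩
    sum (λ i → sum (λ j → entry (E i j (a i j)) p q))
      ≡⟨ sum-cong-≗ (λ i → sum-cong-≗ λ j →
           trans (entry-E i j (a i j) p q) (reorder (δ p i) (δ q j) (a i j))) ⟩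
    sum (λ i → sum (λ j → δ q j * (δ p i * a i j)))
      ≡⟨ sum-cong-≗ (λ i → ∑-δ′ q (λ j → δ p i * a i j)) ⟩
    sum (λ i → δ p i * a i q)
      ≡⟨ ∑-δ′ p (λ i → a i q) ⟩
    a p q ∎)
    where
    a = entry A
    reorder : ∀ x y z → (x * y) * z ≡ y * (x * z)
    reorder = solve 3 (λ x y z → (x ⊕ y) ⊕ z ⊜ y ⊕ (x ⊕ z)) refl

  nonzero-entry : ∀ {s} → s ≢ 0M → ∃[ k ] ∃[ l ] entry s k l ≢ 0#
  nonzero-entry {s} s≢0 =
    let k , row≢0  = ¬∀⟶∃¬ n _ (λ k → all? λ l → entry s k l ≟ 0#) all-zero⇒⊥
        l , s-kl≢0 = ¬∀⟶∃¬ n _ (λ l → entry s k l ≟ 0#) row≢0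
    in k , l , s-kl≢0
    where
    all-zero⇒⊥ : ¬ (∀ k l → entry s k l ≡ 0#)
    all-zero⇒⊥ s≗0 = s≢0 (≡-entrywise λ k l → trans (s≗0 k l) (sym (entry-0M k l)))

module Subbimodules (F : FiniteField) (n : ℕ) where
  open FieldAlgebra F
  open Matrices F n
  open MatrixRing F n
  open MatrixUnits F n
  open ≡-Reasoning

  record IsSubbimodule (W T : Mat → Set) : Set where
    field
      0M∈       : T 0M
      +M-closed : ∀ {a b} → T a → T b → T (a +M b)
      -M-closed : ∀ {a} → T a → T (-M a)
      *ˡ-closed : ∀ {u a} → W u → T a → T (u *M a)
      *ʳ-closed : ∀ {u a} → W u → T a → T (a *M u)

  IsSimpleOver : (Mat → Set) → Set₁
  IsSimpleOver W = ∀ {T} → IsSubbimodule W T → ∀ {s} → s ≢ 0M → T s → ∀ A → T A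

  IsInverseClosed : (Mat → Set) → Set
  IsInverseClosed W = ∀ {u} → W u → ∃[ v ] W v × u *M v ≡ IM × v *M u ≡ IM

  subgroup-inverse-closed : ∀ {U} → IsSubgroupOfGL U → IsInverseClosed U
  subgroup-inverse-closed U-subgroup {u} u∈U with IsSubgroupOfGL.⊆GL U-subgroup u u∈U
  ... | v , uv≡I , vu≡I = v , IsSubgroupOfGL.inv-closed U-subgroup u v u∈U uv≡I vu≡I , uv≡I , vu≡I

  ∑ᴹ-closed : ∀ {W T} → IsSubbimodule W T →
              ∀ {m} {f : Fin m → Mat} → (∀ k → T (f k)) → T (MatrixSum.sum f)
  ∑ᴹ-closed T-sub {ℕ.zero}  f∈T = IsSubbimodule.0M∈ T-sub
  ∑ᴹ-closed T-sub {ℕ.suc m} f∈T =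
    IsSubbimodule.+M-closed T-sub (f∈T zero) (∑ᴹ-closed T-sub (λ k → f∈T (suc k)))

  IsMatrixUnit : Mat → Set
  IsMatrixUnit u = ∃[ i ] ∃[ j ] ∃[ c ] u ≡ E i j c

  matrixUnits-simple : IsSimpleOver IsMatrixUnit
  matrixUnits-simple {T} T-sub {s} s≢0 s∈T A with nonzero-entry s≢0
  ... | k , l , s-kl≢0 with inverse (entry s k l) s-kl≢0
  ... | c , s-kl*c≡1 =
    subst T (sym (E-decomposition A)) (∑ᴹ-closed T-sub λ i → ∑ᴹ-closed T-sub λ j → E∈T i j)
    where
    open IsSubbimodule T-sub
    rescale : ∀ x → ((x * c) * entry s k l) * 1# ≡ x
    rescale x = begin
      ((x * c) * entry s k l) * 1# ≡⟨ *-identityʳ _ ⟩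
      (x * c) * entry s k l        ≡⟨ *-assoc x c (entry s k l) ⟩
      x * (c * entry s k l)        ≡⟨ cong (x *_) (trans (*-comm c (entry s k l)) s-kl*c≡1) ⟩
      x * 1#                       ≡⟨ *-identityʳ x ⟩
      x                            ∎
    E∈T : ∀ i j → T (E i j (entry A i j))
    E∈T i j = subst T (trans (E-sandwich i k l j (entry A i j * c) 1# s) (cong (E i j) (rescale (entry A i j))))
      (*ʳ-closed (l , j , 1# , refl) (*ˡ-closed (i , k , entry A i j * c , refl) s∈T))

  -- The steps r - w of a path from r to 0 in Γ(R,W) lie in W and add up to r.
  sum-along-path : ∀ {W} (P : Mat → Set) → P 0M → (∀ u a → W u → P a → P (u +M a)) →
                   ∀ {r} → Star (CayleyAdj W) r 0M → P r
  sum-along-path P P0 P+ ε = P0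
  sum-along-path {W} P P0 P+ (_◅_ {i = r} {j = w} r-w∈W path) =
    subst P (x-y+y≡x r w) (P+ (r -M w) w r-w∈W (sum-along-path {W} P P0 P+ path))

  connected⇒simple : ∀ {W} → Connected (CayleyAdj W) → IsSimpleOver W
  connected⇒simple {W} W-conn {T} T-sub = matrixUnits-simple record
    { 0M∈       = 0M∈
    ; +M-closed = +M-closed
    ; -M-closed = -M-closed
    ; *ˡ-closed = λ {u} {a} _ → sum-along-path {W} LeftMultiplier 0M-left +-left (W-conn u 0M) a
    ; *ʳ-closed = λ {u} {a} _ → sum-along-path {W} RightMultiplier 0M-right +-right (W-conn u 0M) a
    }
    where
    open IsSubbimodule T-sub
    LeftMultiplier RightMultiplier : Mat → Set
    LeftMultiplier r = ∀ a → T a → T (r *M a)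
    RightMultiplier r = ∀ a → T a → T (a *M r)
    0M-left : LeftMultiplier 0M
    0M-left a _ = subst T (sym (*M-zeroˡ a)) 0M∈
    0M-right : RightMultiplier 0M
    0M-right a _ = subst T (sym (*M-zeroʳ a)) 0M∈
    +-left : ∀ u r → W u → LeftMultiplier r → LeftMultiplier (u +M r)
    +-left u r u∈W r-left a a∈T =
      subst T (sym (*M-distribʳ a u r)) (+M-closed (*ˡ-closed u∈W a∈T) (r-left a a∈T))
    +-right : ∀ u r → W u → RightMultiplier r → RightMultiplier (u +M r)
    +-right u r u∈W r-right a a∈T =
      subst T (sym (*M-distribˡ a u r)) (+M-closed (*ʳ-closed u∈W a∈T) (r-right a a∈T))

module Transvections (F : FiniteField) (n : ℕ) where
  open FieldAlgebra F
  open Matrices F n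
  open MatrixRing F n
  open MatrixUnits F n
  open Subbimodules F n
  open ≡-Reasoning

  transvection : Fin n → Fin n → Carrier → Mat
  transvection i j c = IM +M E i j c

  IsTransvection : Mat → Set
  IsTransvection u = ∃[ i ] ∃[ j ] ∃[ c ] i ≢ j × u ≡ transvection i j c

  transvection-*M : ∀ i j c a → transvection i j c *M a ≡ a +M (E i j c *M a)
  transvection-*M i j c a = trans (*M-distribʳ a IM (E i j c)) (cong (_+M (E i j c *M a)) (*M-identityˡ a))

  *M-transvection : ∀ i j c a → a *M transvection i j c ≡ a +M (a *M E i j c)
  *M-transvection i j c a = trans (*M-distribˡ a IM (E i j c)) (cong (_+M (a *M E i j c)) (*M-identityʳ a))

  transvection-inverse : ∀ {i j} → i ≢ j → ∀ c → transvection i j c *M transvection i j (- c) ≡ IM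
  transvection-inverse {i} {j} i≢j c = begin
    transvection i j c *M transvection i j (- c)
      ≡⟨ transvection-*M i j c (transvection i j (- c)) ⟩
    transvection i j (- c) +M (E i j c *M transvection i j (- c))
      ≡⟨ cong (transvection i j (- c) +M_) (*M-transvection i j (- c) (E i j c)) ⟩
    transvection i j (- c) +M (E i j c +M (E i j c *M E i j (- c)))
      ≡⟨ cong (λ x → transvection i j (- c) +M (E i j c +M x)) (E*E-≢ i≢j c (- c)) ⟩
    transvection i j (- c) +M (E i j c +M 0M)
      ≡⟨ cong (transvection i j (- c) +M_) (+M-identityʳ (E i j c)) ⟩
    (IM +M E i j (- c)) +M E i j c
      ≡⟨ +M-assoc IM (E i j (- c)) (E i j c) ⟩
    IM +M (E i j (- c) +M E i j c)
      ≡⟨ cong (IM +M_) (trans (sym (E-+ i j (- c) c)) (trans (cong (E i j) (-‿inverseˡ c)) (E-zero i j))) ⟩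
    IM +M 0M
      ≡⟨ +M-identityʳ IM ⟩
    IM ∎

  transvection-inverse′ : ∀ {i j} → i ≢ j → ∀ c → transvection i j (- c) *M transvection i j c ≡ IM
  transvection-inverse′ {i} {j} i≢j c =
    subst (λ x → transvection i j (- c) *M transvection i j x ≡ IM) (-‿involutive c)
          (transvection-inverse i≢j (- c))

  transvection-inverse-closed : IsInverseClosed IsTransvection
  transvection-inverse-closed (i , j , c , i≢j , refl) =
    transvection i j (- c) , (i , j , - c , i≢j , refl) , transvection-inverse i≢j c , transvection-inverse′ i≢j c

  transvection∈GL : ∀ {u} → IsTransvection u → GL u
  transvection∈GL u-tv with transvection-inverse-closed u-tv
  ... | v , _ , uv≡I , vu≡I = v , uv≡I , vu≡I

  entry-transvection : ∀ i j c p q → entry (transvection i j c) p q ≡ δ p q + (δ p i * δ q j) * c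
  entry-transvection i j c p q =
    trans (entry-+M IM (E i j c) p q) (cong₂ _+_ (entry-IM p q) (entry-E i j c p q))

  entry-transvection-off : ∀ {i j} c {p q} → p ≢ q → ¬ (p ≡ i × q ≡ j) →
                           entry (transvection i j c) p q ≡ 0#
  entry-transvection-off {i} {j} c {p} {q} p≢q ¬pq≡ij = begin
    entry (transvection i j c) p q ≡⟨ entry-transvection i j c p q ⟩
    δ p q + (δ p i * δ q j) * c    ≡⟨ cong₂ _+_ (δ-≢ p≢q) (trans (cong (_* c) (δδ≡0 ¬pq≡ij)) (zeroˡ c)) ⟩
    0# + 0#                        ≡⟨ +-identityʳ 0# ⟩
    0#                             ∎
    where open ≡-Reasoning

  entry-transvection-diag : ∀ {i j} → i ≢ j → ∀ c p → entry (transvection i j c) p p ≡ 1#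
  entry-transvection-diag {i} {j} i≢j c p = begin
    entry (transvection i j c) p p ≡⟨ entry-transvection i j c p p ⟩
    δ p p + (δ p i * δ p j) * c    ≡⟨ cong₂ _+_ (δ-refl p) (trans (cong (_* c) (δδ≡0 ¬[p≡i×p≡j])) (zeroˡ c)) ⟩
    1# + 0#                        ≡⟨ +-identityʳ 1# ⟩
    1#                             ∎
    where
    open ≡-Reasoning
    ¬[p≡i×p≡j] : ¬ (p ≡ i × p ≡ j)
    ¬[p≡i×p≡j] (refl , p≡j) = i≢j p≡j

  transvections-simple : (∀ (i : Fin n) → ∃[ j ] i ≢ j) → IsSimpleOver IsTransvection
  transvections-simple other-index {T} T-sub = matrixUnits-simple record
    { 0M∈       = 0M∈
    ; +M-closed = +M-closed
    ; -M-closed = -M-closed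
    ; *ˡ-closed = λ { (i , j , c , refl) → E-left i j c }
    ; *ʳ-closed = λ { (i , j , c , refl) → E-right i j c }
    }
    where
    open IsSubbimodule T-sub
    [x+y]-x≡y : ∀ x y → (x +M y) -M x ≡ y
    [x+y]-x≡y x y = trans (cong (_-M x) (+M-comm x y)) (//-rightDividesʳ x y)
    off-diagonal-left : ∀ {i j} → i ≢ j → ∀ c {a} → T a → T (E i j c *M a)
    off-diagonal-left {i} {j} i≢j c {a} a∈T =
      subst T (trans (cong (_-M a) (transvection-*M i j c a)) ([x+y]-x≡y a _))
        (+M-closed (*ˡ-closed (i , j , c , i≢j , refl) a∈T) (-M-closed a∈T))
    off-diagonal-right : ∀ {i j} → i ≢ j → ∀ c {a} → T a → T (a *M E i j c)
    off-diagonal-right {i} {j} i≢j c {a} a∈T =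
      subst T (trans (cong (_-M a) (*M-transvection i j c a)) ([x+y]-x≡y a _))
        (+M-closed (*ʳ-closed (i , j , c , i≢j , refl) a∈T) (-M-closed a∈T))
    E-left : ∀ i j c {a} → T a → T (E i j c *M a)
    E-left i j c {a} a∈T with i Fin.≟ j | other-index i
    ... | no i≢j  | _         = off-diagonal-left i≢j c a∈T
    ... | yes refl | k , i≢k  =
      subst T (trans (sym (*M-assoc (E i k c) (E k i 1#) a)) (cong (_*M a) (E*E-diagonal i k c)))
        (off-diagonal-left i≢k c (off-diagonal-left (λ k≡i → i≢k (sym k≡i)) 1# a∈T))
    E-right : ∀ i j c {a} → T a → T (a *M E i j c)
    E-right i j c {a} a∈T with i Fin.≟ j | other-index i
    ... | no i≢j  | _         = off-diagonal-right i≢j c a∈T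
    ... | yes refl | k , i≢k  =
      subst T (trans (*M-assoc a (E i k c) (E k i 1#)) (cong (a *M_) (E*E-diagonal i k c)))
        (off-diagonal-right (λ k≡i → i≢k (sym k≡i)) 1# (off-diagonal-right i≢k c a∈T))

module Determinants (F : FiniteField) (n : ℕ) where
  open FieldAlgebra F
  open Matrices F n
  open MatrixRing F n using (sumFin≡sum; entry-+M; entry-IM)
  open MatrixUnits F n using (E; entry-E)
  open Transvections F n
    using (transvection; IsTransvection; entry-transvection-off; entry-transvection-diag)

  at : ∀ {m} → SqMat m → Fin m → Fin m → Carrier
  at M i j = lookup (lookup M i) j

  minor : ∀ {m} → Vec (Vec Carrier (ℕ.suc m)) m → Fin (ℕ.suc m) → SqMat m
  minor rs j = map (λ row → removeAt row j) rs

  IsUnitUpperTriangular IsUnitLowerTriangular : ∀ {m} → SqMat m → Set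
  IsUnitUpperTriangular M = (∀ i j → j Fin.< i → at M i j ≡ 0#) × (∀ i → at M i i ≡ 1#)
  IsUnitLowerTriangular M = (∀ i j → i Fin.< j → at M i j ≡ 0#) × (∀ i → at M i i ≡ 1#)

  det-∷ : ∀ {m} r (rs : Vec (Vec Carrier (ℕ.suc m)) m) →
          det (r ∷ rs) ≡ sum (λ j → sgn j * lookup r j * det (minor rs j))
  det-∷ r rs = sumFin≡sum (λ j → sgn j * lookup r j * det (minor rs j))

  at-minor : ∀ {m} (rs : Vec (Vec Carrier (ℕ.suc m)) m) j i k →
             at (minor rs j) i k ≡ lookup (removeAt (lookup rs i) j) k
  at-minor rs j i k = cong (λ row → lookup row k) (lookup-map i (λ row → removeAt row j) rs)

  at-minor-zero : ∀ {m} r (rs : Vec (Vec Carrier (ℕ.suc m)) m) i k →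
                  at (minor rs zero) i k ≡ at (r ∷ rs) (suc i) (suc k)
  at-minor-zero r rs i k = trans (at-minor rs zero i k) (removeAt-punchOut (lookup rs i) λ ())

  ∑-head : ∀ {m} (f : Fin (ℕ.suc m) → Carrier) → (∀ j → f (suc j) ≡ 0#) → sum f ≡ f zero
  ∑-head f tail≡0 = trans (cong (f zero +_) (∑-zero tail≡0)) (+-identityʳ _)

  mutual
    det-zero-column : ∀ {m} (M : SqMat (ℕ.suc m)) → (∀ i → at M i zero ≡ 0#) → det M ≡ 0#
    det-zero-column {m} (r ∷ rs) col≡0 = trans (det-∷ r rs) (∑-zero term≡0)
      where
      term≡0 : ∀ j → sgn j * lookup r j * det (minor rs j) ≡ 0#
      term≡0 zero    = trans (cong (λ x → sgn {ℕ.suc m} zero * x * det (minor rs zero)) (col≡0 zero))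
                             (trans (cong (_* det (minor rs zero)) (zeroʳ _)) (zeroˡ _))
      term≡0 (suc j) = trans (cong (sgn (suc j) * lookup r (suc j) *_)
                                   (det-minor-suc j rs (λ i → col≡0 (suc i))))
                             (zeroʳ _)

    det-minor-suc : ∀ {m} (j : Fin m) (rs : Vec (Vec Carrier (ℕ.suc m)) m) →
                    (∀ i → lookup (lookup rs i) zero ≡ 0#) → det (minor rs (suc j)) ≡ 0#
    det-minor-suc {ℕ.suc m} j rs col≡0 = det-zero-column (minor rs (suc j)) λ i →
      trans (at-minor rs (suc j) i zero) (trans (removeAt-punchOut (lookup rs i) λ ()) (col≡0 i))

  det-unitUpper : ∀ {m} (M : SqMat m) → IsUnitUpperTriangular M → det M ≡ 1#
  det-unitUpper []       _                = refl
  det-unitUpper (r ∷ rs) (lower≡0 , diag≡1) = begin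
    det (r ∷ rs)
      ≡⟨ det-∷ r rs ⟩
    sum (λ j → sgn j * lookup r j * det (minor rs j))
      ≡⟨ ∑-head (λ j → sgn j * lookup r j * det (minor rs j)) tail≡0 ⟩
    1# * lookup r zero * det (minor rs zero)
      ≡⟨ cong₂ (λ x y → 1# * x * y) (diag≡1 zero) (det-unitUpper (minor rs zero) minor-upper) ⟩
    1# * 1# * 1#
      ≡⟨ trans (*-identityʳ _) (*-identityʳ _) ⟩
    1# ∎
    where
    open ≡-Reasoning
    tail≡0 : ∀ j → sgn (suc j) * lookup r (suc j) * det (minor rs (suc j)) ≡ 0#
    tail≡0 j = trans (cong (sgn (suc j) * lookup r (suc j) *_)
                           (det-minor-suc j rs (λ i → lower≡0 (suc i) zero (s≤s z≤n))))
                     (zeroʳ _)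
    minor-upper : IsUnitUpperTriangular (minor rs zero)
    minor-upper = (λ i k k<i → trans (at-minor-zero r rs i k) (lower≡0 (suc i) (suc k) (s≤s k<i)))
                , (λ i → trans (at-minor-zero r rs i i) (diag≡1 (suc i)))

  det-unitLower : ∀ {m} (M : SqMat m) → IsUnitLowerTriangular M → det M ≡ 1#
  det-unitLower []       _                = refl
  det-unitLower (r ∷ rs) (upper≡0 , diag≡1) = begin
    det (r ∷ rs)
      ≡⟨ det-∷ r rs ⟩
    sum (λ j → sgn j * lookup r j * det (minor rs j))
      ≡⟨ ∑-head (λ j → sgn j * lookup r j * det (minor rs j)) tail≡0 ⟩
    1# * lookup r zero * det (minor rs zero)
      ≡⟨ cong₂ (λ x y → 1# * x * y) (diag≡1 zero) (det-unitLower (minor rs zero) minor-lower) ⟩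
    1# * 1# * 1#
      ≡⟨ trans (*-identityʳ _) (*-identityʳ _) ⟩
    1# ∎
    where
    open ≡-Reasoning
    tail≡0 : ∀ j → sgn (suc j) * lookup r (suc j) * det (minor rs (suc j)) ≡ 0#
    tail≡0 j = trans (cong (λ x → sgn (suc j) * x * det (minor rs (suc j))) (upper≡0 zero (suc j) (s≤s z≤n)))
                     (trans (cong (_* det (minor rs (suc j))) (zeroʳ _)) (zeroˡ _))
    minor-lower : IsUnitLowerTriangular (minor rs zero)
    minor-lower = (λ i k i<k → trans (at-minor-zero r rs i k) (upper≡0 (suc i) (suc k) (s≤s i<k)))
                , (λ i → trans (at-minor-zero r rs i i) (diag≡1 (suc i)))

  det-IM : det IM ≡ 1#
  det-IM = det-unitUpper IM ( (λ p q q<p → trans (entry-IM p q) (δ-≢ (λ p≡q → <⇒≢ q<p (sym p≡q))))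
                            , (λ p → trans (entry-IM p p) (δ-refl p)) )

  det-transvection : ∀ {i j} → i ≢ j → ∀ c → det (transvection i j c) ≡ 1#
  det-transvection {i} {j} i≢j c with <-cmp i j
  ... | tri≈ _ i≡j _ = ⊥-elim (i≢j i≡j)
  ... | tri< i<j _ _ = det-unitUpper (transvection i j c)
    ( (λ p q q<p → entry-transvection-off c (λ p≡q → <⇒≢ q<p (sym p≡q)) λ { (refl , refl) → <-asym i<j q<p })
    , entry-transvection-diag i≢j c )
  ... | tri> _ _ j<i = det-unitLower (transvection i j c)
    ( (λ p q p<q → entry-transvection-off c (<⇒≢ p<q) λ { (refl , refl) → <-asym j<i p<q })
    , entry-transvection-diag i≢j c )

  transvection∈SL : ∀ {u} → IsTransvection u → SL u
  transvection∈SL (i , j , c , i≢j , refl) = det-transvection i≢j c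

module UnitaryCayley (F : FiniteField) (n : ℕ) where
  open FiniteField F using (Carrier; enum)
  open Matrices F n
  open MatrixRing F n
  open Subbimodules F n
  open Homogeneity F n
  open Enumeration

  elements : List Carrier
  elements = List.tabulate (Inverse.from enum)

  ∈-elements : ∀ x → x ∈ₗ elements
  ∈-elements x = subst (_∈ₗ elements) (Inverse.strictlyInverseʳ enum x) (∈-tabulate⁺ (Inverse.to enum x))

  ∈-matrices : ∀ A → A ∈ₗ vectors (vectors elements n) n
  ∈-matrices = ∈-vectors (∈-vectors ∈-elements)

  complement-size : Subset → ℕ
  complement-size X = outside X (vectors (vectors elements n) n)

  module _ {W : Mat → Set} (W-simple : IsSimpleOver W) (W-inverse : IsInverseClosed W) where

    module Connectivity (C : Mat → Set) (C-neg : ∀ {d} → C d → C (-M d))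
                        (C-*ˡ : ∀ {u d} → W u → C d → C (u *M d))
                        (C-*ʳ : ∀ {u d} → W u → C d → C (d *M u)) where

      Path : Mat → Mat → Set
      Path = Star (CayleyAdj C)

      translate : ∀ t {x y} → Path x y → Path (x +M t) (y +M t)
      translate t = gmap (_+M t) λ {x} {y} → subst C (sym ([x+z]-[y+z]≡x-y x y t))

      reverse : ∀ {x y} → Path x y → Path y x
      reverse = Star.reverse λ {x} {y} → subst C (-[x-y]≡y-x x y) ∘ C-neg

      reachable-subbimodule : IsSubbimodule W (Path 0M)
      reachable-subbimodule = record
        { 0M∈       = ε
        ; +M-closed = λ {a} {b} 0→a 0→b →
            0→a ◅◅ subst₂ Path (+M-identityˡ a) (+M-comm b a) (translate a 0→b)
        ; -M-closed = λ {a} 0→a →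
            reverse (subst₂ Path (+M-identityˡ (-M a)) (-M-inverseʳ a) (translate (-M a) 0→a))
        ; *ˡ-closed = λ {u} {a} u∈W 0→a → subst (λ x → Path x (u *M a)) (*M-zeroʳ u)
            (gmap (u *M_) (λ {x} {y} → subst C (x[y-z]≡xy-xz u x y) ∘ C-*ˡ u∈W) 0→a)
        ; *ʳ-closed = λ {u} {a} u∈W 0→a → subst (λ x → Path x (a *M u)) (*M-zeroˡ u)
            (gmap (_*M u) (λ {x} {y} → subst C ([y-z]x≡yx-zx u x y) ∘ C-*ʳ u∈W) 0→a)
        }

      connected : ∀ {s} → s ≢ 0M → C s → Connected (CayleyAdj C)
      connected {s} s≢0 s∈C a b = subst₂ Path (+M-identityˡ a) (x-y+y≡x b a)
        (translate a (W-simple reachable-subbimodule s≢0 0→s (b -M a)))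
        where
        0→s : Path 0M s
        0→s = subst C (sym (+M-identityˡ (-M s))) (C-neg s∈C) ◅ ε

    module _ {S : Subset} (S-connection-set : IsConnectionSet S)
             (S-*ˡ : ∀ {u a} → W u → a ∈ S → (u *M a) ∈ S)
             (S-*ʳ : ∀ {u a} → W u → a ∈ S → (a *M u) ∈ S) where

      Adj : Mat → Mat → Set
      Adj = CayleyAdj (_∈ S)

      0∉S : 0M ∉ S
      0∉S = proj₁ S-connection-set

      S-neg : ∀ {a} → a ∈ S → (-M a) ∈ S
      S-neg {a} = Equivalence.to (proj₂ S-connection-set a)

      S-unneg : ∀ {a} → (-M a) ∈ S → a ∈ S
      S-unneg {a} = Equivalence.from (proj₂ S-connection-set a)

      S-cancelˡ : ∀ {u a} → W u → (u *M a) ∈ S → a ∈ S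
      S-cancelˡ {u} {a} u∈W ua∈S with W-inverse u∈W
      ... | v , v∈W , _ , vu≡I = subst (_∈ S) (*M-cancelˡ {u} {v} vu≡I a) (S-*ˡ v∈W ua∈S)

      S-cancelʳ : ∀ {u a} → W u → (a *M u) ∈ S → a ∈ S
      S-cancelʳ {u} {a} u∈W au∈S with W-inverse u∈W
      ... | v , v∈W , uv≡I , _ = subst (_∈ S) (*M-cancelʳ {u} {v} uv≡I a) (S-*ʳ v∈W au∈S)

      Adj-sym : Symmetric Adj
      Adj-sym {a} {b} = subst (_∈ S) (-[x-y]≡y-x a b) ∘ S-neg

      Adj? : ∀ a b → Dec (Adj a b)
      Adj? a b = (a -M b) ∈? S

      Adj-connected : ∀ {s} → s ∈ S → Connected Adj
      Adj-connected s∈S = Connectivity.connected (_∈ S) S-neg S-*ˡ S-*ʳ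
        (λ s≡0 → 0∉S (subst (_∈ S) s≡0 s∈S)) s∈S

      complement-connected : ∀ {t} → t ≢ 0M → t ∉ S → Connected (Complement Adj)
      complement-connected = Connectivity.connected (_∉ S)
        (λ a∉S -a∈S → a∉S (S-unneg -a∈S))
        (λ u∈W a∉S ua∈S → a∉S (S-cancelˡ u∈W ua∈S))
        (λ u∈W a∉S au∈S → a∉S (S-cancelʳ u∈W au∈S))

      translation-iso : ∀ t a b → Adj (a +M t) (b +M t) ⇔ Adj a b
      translation-iso t a b = mk⇔ (subst (_∈ S) ([x+z]-[y+z]≡x-y a b t))
                                  (subst (_∈ S) (sym ([x+z]-[y+z]≡x-y a b t)))

      left-iso : ∀ {u} → W u → ∀ a b → Adj (u *M a) (u *M b) ⇔ Adj a b
      left-iso {u} u∈W a b = mk⇔ (λ ~ → S-cancelˡ u∈W (subst (_∈ S) (sym (x[y-z]≡xy-xz u a b)) ~))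
                                 (λ ~ → subst (_∈ S) (x[y-z]≡xy-xz u a b) (S-*ˡ u∈W ~))

      right-iso : ∀ {u} → W u → ∀ a b → Adj (a *M u) (b *M u) ⇔ Adj a b
      right-iso {u} u∈W a b = mk⇔ (λ ~ → S-cancelʳ u∈W (subst (_∈ S) (sym ([y-z]x≡yx-zx u a b)) ~))
                                  (λ ~ → subst (_∈ S) ([y-z]x≡yx-zx u a b) (S-*ʳ u∈W ~))

      module Maximality (connected : Connected Adj) (co-connected : Connected (Complement Adj))
                        {d} (d≢0 : d ≢ 0M) where

        homogeneous-full : ∀ X → Acc _<_ (complement-size X) →
                           IsHomogeneous Adj X → 0M ∈ X → d ∈ X → ∀ z → z ∈ X
        homogeneous-full X (acc smaller) X-hom 0∈X d∈X z with z ∈? X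
        ... | yes z∈X = z∈X
        ... | no  z∉X = W-simple X-subbimodule d≢0 d∈X z
          where
          -- If y ∉ X, then X ∪ Y is a strictly larger homogeneous set, hence all of R by
          -- induction, and the cover lemma makes Y all of R.
          absorb : ∀ {Y} → IsHomogeneous Adj Y → 0M ∈ Y → ∀ {z′} → z′ ∉ Y →
                   ∀ {y} → y ∈ Y → y ∈ X
          absorb {Y} Y-hom 0∈Y {z′} z′∉Y {y} y∈Y with y ∈? X
          ... | yes y∈X = y∈X
          ... | no  y∉X = ⊥-elim (z′∉Y (Y-full z′))
            where
            X∪Y-full : ∀ w → w ∈ (X ∪ Y)
            X∪Y-full = homogeneous-full (X ∪ Y)
              (smaller (outside-< (λ w → ∪-introˡ {X} {Y}) (∈-matrices y) (∪-introʳ {X} {Y} y∈Y) y∉X))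
              (∪-homogeneous {Adj = Adj} X-hom Y-hom 0∈X 0∈Y) (∪-introˡ {X} {Y} 0∈X) (∪-introˡ {X} {Y} d∈X)
            Y-full : ∀ w → w ∈ Y
            Y-full w with w ∈? Y | ∪-elim {X} {Y} (X∪Y-full w)
            ... | yes w∈Y | _        = w∈Y
            ... | no  w∉Y | inj₂ w∈Y = ⊥-elim (w∉Y w∈Y)
            ... | no  w∉Y | inj₁ w∈X = ⊥-elim (homogeneous-cover {Adj = Adj}
                (λ {a} {b} → Adj-sym {a} {b}) Adj? connected co-connected
                X-hom Y-hom (λ v → ∪-elim {X} {Y} (X∪Y-full v)) w∈X w∉Y y∈Y y∉X)

          absorb-image : (φ ψ : Mat → Mat) → (∀ a b → Adj (φ a) (φ b) ⇔ Adj a b) → φ 0M ∈ X →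
                         (∀ a → φ (ψ a) ≡ a) → ∀ {a} → a ∈ X → ψ a ∈ X
          absorb-image φ ψ φ-iso φ0∈X φψ≗id {a} a∈X =
            absorb (preimage-homogeneous {Adj = Adj} φ φ-iso X-hom) φ0∈X {ψ z}
              (λ φψz∈X → z∉X (subst (_∈ X) (φψ≗id z) φψz∈X))
              (subst (_∈ X) (sym (φψ≗id a)) a∈X)

          difference-closed : ∀ {a t} → a ∈ X → t ∈ X → (a -M t) ∈ X
          difference-closed {a} {t} a∈X t∈X = absorb-image (_+M t) (_-M t) (translation-iso t)
            (subst (_∈ X) (sym (+M-identityˡ t)) t∈X) (λ b → x-y+y≡x b t) a∈X

          neg-closed : ∀ {a} → a ∈ X → (-M a) ∈ X
          neg-closed {a} a∈X = subst (_∈ X) (+M-identityˡ (-M a)) (difference-closed 0∈X a∈X)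

          X-subbimodule : IsSubbimodule W (_∈ X)
          X-subbimodule = record
            { 0M∈       = 0∈X
            ; +M-closed = λ {a} {b} a∈X b∈X → subst (_∈ X) (x-[-y]≡x+y a b) (difference-closed a∈X (neg-closed b∈X))
            ; -M-closed = neg-closed
            ; *ˡ-closed = λ {u} u∈W → let (v , v∈W , _ , vu≡I) = W-inverse u∈W in
                absorb-image (v *M_) (u *M_) (left-iso v∈W) (subst (_∈ X) (sym (*M-zeroʳ v)) 0∈X)
                  (*M-cancelˡ {u} {v} vu≡I)
            ; *ʳ-closed = λ {u} u∈W → let (v , v∈W , uv≡I , _) = W-inverse u∈W in
                absorb-image (_*M v) (_*M u) (right-iso v∈W) (subst (_∈ X) (sym (*M-zeroˡ v)) 0∈X)
                  (*M-cancelʳ {u} {v} uv≡I)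
            }

      cayley-prime : ∀ {s} → s ∈ S → ∀ {t} → t ≢ 0M → t ∉ S → IsPrime Adj
      cayley-prime s∈S t≢0 t∉S X X-hom ((x , y , x∈X , y∈X , x≢y) , (z , z∉X)) =
        z∉X (subst (_∈ X) (x-y+y≡x z x) z-x∈X-x)
        where
        open Maximality (Adj-connected s∈S) (complement-connected t≢0 t∉S)
        y-x≢0 : y -M x ≢ 0M
        y-x≢0 y-x≡0 = x≢y (sym (trans (sym (x-y+y≡x y x)) (trans (cong (_+M x) y-x≡0) (+M-identityˡ x))))
        z-x∈X-x : (z -M x) ∈ (X ∘ (_+M x))
        z-x∈X-x = homogeneous-full y-x≢0 (X ∘ (_+M x)) (<-wellFounded _)
          (preimage-homogeneous {Adj = Adj} (_+M x) (translation-iso x) X-hom)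
          (subst (_∈ X) (sym (+M-identityˡ x)) x∈X)
          (subst (_∈ X) (sym (x-y+y≡x y x)) y∈X)
          (z -M x)

  unitary-prime : ∀ (U W : Mat → Set) → U IM → (∀ {u} → W u → U u) →
                  IsInverseClosed W → IsSimpleOver W → AllUnitaryPrime U
  unitary-prime U W I∈U W⊆U W-inverse W-simple S S-connection-set S-unitary S≢∅ S≢R∖0 X X-hom X-nontrivial =
    S≢∅ λ s s∈S → S≢R∖0 λ t → mk⇔
      (λ t∈S t≡0 → proj₁ S-connection-set (subst (_∈ S) t≡0 t∈S))
      (λ t≢0 → decidable-stable (t ∈? S) λ t∉S →
        cayley-prime W-simple W-inverse S-connection-set S-*ˡ S-*ʳ s∈S t≢0 t∉S X X-hom X-nontrivial)
    where
    S-*ˡ : ∀ {u a} → W u → a ∈ S → (u *M a) ∈ S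
    S-*ˡ {u} {a} u∈W a∈S = Equivalence.from (S-unitary (u *M a))
      (u , IM , a , W⊆U u∈W , I∈U , a∈S , sym (*M-identityʳ (u *M a)))
    S-*ʳ : ∀ {u a} → W u → a ∈ S → (a *M u) ∈ S
    S-*ʳ {u} {a} u∈W a∈S = Equivalence.from (S-unitary (a *M u))
      (IM , u , a , I∈U , W⊆U u∈W , a∈S , cong (_*M u) (sym (*M-identityˡ a)))

mainTheorem10 :
    (F : FiniteField) (n : ℕ) → 2 < n →
    let open Matrices F n in
    (∀ (U : Mat → Set) → IsSubgroupOfGL U → U (-M IM) →
       Connected (CayleyAdj U) → AllUnitaryPrime U)
    × AllUnitaryPrime GL
    × (det (-M IM) ≡ FiniteField.1# F → AllUnitaryPrime SL)
mainTheorem10 F n 2<n =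
    (λ U U-subgroup _ U-connected → unitary-prime U U (has-I U-subgroup) (λ u∈U → u∈U)
                                       (subgroup-inverse-closed U-subgroup) (connected⇒simple U-connected))
  , unitary-prime GL IsTransvection (IM , *M-identityˡ IM , *M-identityˡ IM) transvection∈GL
                  transvection-inverse-closed simple-over-transvections
  , λ _ → unitary-prime SL IsTransvection det-IM transvection∈SL
                        transvection-inverse-closed simple-over-transvections
  where
  open Matrices F n
  open MatrixRing F n using (*M-identityˡ)
  open Subbimodules F n
  open Transvections F n
  open Determinants F n
  open UnitaryCayley F n
  open IsSubgroupOfGL


  simple-over-transvections : IsSimpleOver IsTransvection
  simple-over-transvections = transvections-simple (other-index (<⇒≤ 2<n))
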